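{- Let $\Sigma=\{s_0,s_1,\dots,s_{\sigma-1}\}$ be an ordered alphabet of size $\sigma\ge 1$ with $s_0<s_1<\dots<s_{\sigma-1}$, and let \[K = s_{\sigma-1}^{k_{\sigma-1}}\, s_{\sigma-2}^{k_{\sigma-2}} \cdots s_1^{k_1}\, s_0^{k_0}\] with integers $k_i>1$ for all $i$. Then a smallest suffixient set for $K\$$ has size $\chi=2\sigma$.
   Context: Here $\$\notin\Sigma$ is an end-marker smaller than every letter of $\Sigma$; $K\$$ is $K$ followed by one $\$$, viewed as a string over $\Sigma\cup\{\$\}$. Strings are 0-indexed and $w[0..j]$ is the prefix of $w$ ending at position $j$. For a string $w$, a substring $x$ of $w$ (possibly empty) is right-maximal if there are distinct letters $a\neq b$ such that both $xa$ and $xb$ are substrings of $w$; the right-extensions of $w$ are the strings $xa$ with $x$ right-maximal and $xa$ a substring of $w$. A set $S$ of positions of $w$ is suffixient if for every right-extension $y$ of $w$ there is $j\in S$ such that $y$ is a suffix of $w[0..j]$. $\chi$ is the minimum size of a suffixient set of $K\$$. -}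

module Defs where

open import Data.Nat using (ℕ; suc; _≤_)
open import Data.Fin using (Fin; zero; suc; toℕ)
open import Data.List using (List; []; _∷_; _++_; [_]; take; length; replicate; concatMap; reverse; allFin)
open import Data.Fin.Subset using (Subset; _∈_; ∣_∣)
open import Data.Product using (Σ; ∃; ∃-syntax; _×_)
open import Relation.Binary.PropositionalEquality using (_≡_; _≢_)

module _ {A : Set} where

  Substring : List A → List A → Set
  Substring x w = ∃[ u ] ∃[ v ] w ≡ u ++ x ++ v

  Suffix : List A → List A → Set
  Suffix y z = ∃[ u ] z ≡ u ++ y

  RightMaximal : List A → List A → Set
  RightMaximal w x = ∃[ a ] ∃[ b ] a ≢ b × Substring (x ++ [ a ]) w × Substring (x ++ [ b ]) w

  RightExtension : List A → List A → Set
  RightExtension w y = ∃[ x ] ∃[ a ] y ≡ x ++ [ a ] × RightMaximal w x × Substring (x ++ [ a ]) w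

  prefixTo : (w : List A) → Fin (length w) → List A
  prefixTo w j = take (suc (toℕ j)) w

  Suffixient : (w : List A) → Subset (length w) → Set
  Suffixient w S = ∀ y → RightExtension w y → ∃[ j ] j ∈ S × Suffix y (prefixTo w j)

  MinSuffixientSize : List A → ℕ → Set
  MinSuffixientSize w n =
    (∃[ S ] Suffixient w S × ∣ S ∣ ≡ n) × (∀ S → Suffixient w S → n ≤ ∣ S ∣)

-- Alphabet Σ ∪ {$} encoded as Fin (suc σ): zero is $, suc i is the letter s_i.
-- (So $ < s_0 < ... < s_{σ-1} in the Fin order.)
Letter : ℕ → Set
Letter σ = Fin (suc σ)

Kstr : (σ : ℕ) → (Fin σ → ℕ) → List (Letter σ)
Kstr σ k = concatMap (λ i → replicate (k i) (suc i)) (reverse (allFin σ))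

K$ : (σ : ℕ) → (Fin σ → ℕ) → List (Letter σ)
K$ σ k = Kstr σ k ++ [ zero ]

-- In a word whose letters never increase, every letter occupies a single run and every pair p q
-- of distinct adjacent letters occurs exactly once. Hence a right-maximal string, which has two
-- occurrences followed by different letters, cannot contain such a pair: it is a power e^m of one
-- letter, and each of its right-extensions has an occurrence ending at the last letter of a run or
-- at the first letter of the next run. So the set of positions adjacent to a letter change is
-- suffixient. Conversely, if p^(m+2) is the whole run of p and it is followed by q, then p^(m+1)
-- is right-maximal and its right-extensions p^(m+2) and p^(m+1) q each occur exactly once (the
-- second because the run has length at least 2), ending at the two positions around the change;
-- so every suffixient set contains both. The word K$ has σ letter changes, all between runs of
-- length at least 2, which gives 2σ positions.
module Submission where

open import Defs
open import Data.Bool using (Bool; true; false; not; _∨_)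
open import Data.Bool.Properties using (∨-zeroʳ; ∨-identityʳ)
open import Data.Empty using (⊥; ⊥-elim)
open import Data.Fin using (Fin; zero; suc; toℕ; _≟_; _≥_)
import Data.Fin as Fin
open import Data.Fin.Properties using (toℕ-injective; toℕ<n; ≤-antisym; ≤∧≢⇒<; <⇒≢)
open import Data.Fin.Subset using (Subset; _∈_; _⊆_; ∣_∣)
open import Data.Fin.Subset.Properties using (p⊆q⇒∣p∣≤∣q∣)
open import Data.List
  using (List; []; _∷_; _++_; [_]; take; drop; length; replicate; filter; map; concatMap; reverse; allFin; tabulate)
open import Data.List.Properties
  using ( ++-assoc; ++-identityʳ; ++-cancelˡ; ++-cancelʳ; length-++; length-replicate; length-take; take++drop≡id
        ; ∷-injective; ∷-injectiveˡ; ∷-injectiveʳ; ∷ʳ-injectiveˡ; filter-++; filter-all; filter-none; filter-some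
        ; map-++; map-replicate; map-tabulate; unfold-reverse; reverse-map
        ; concatMap-++; concatMap-map; concatMap-cong; map-concatMap )
open import Data.List.Membership.Propositional.Properties using (∈-allFin; ∈-∃++)
open import Data.List.Relation.Unary.All as All using (All; []; _∷_)
import Data.List.Relation.Unary.All.Properties as Allₚ
open import Data.List.Relation.Unary.Any.Properties using (reverse⁺)
open import Data.List.Relation.Unary.AllPairs as AllPairs using (AllPairs; []; _∷_)
import Data.List.Relation.Unary.AllPairs.Properties as AllPairsₚ
open import Data.Nat using (ℕ; zero; suc; _+_; _*_; _≤_; _<_; s≤s; z≤n)
open import Data.Nat.Properties
  using ( +-assoc; +-comm; +-suc; +-identityʳ; +-cancelʳ-≡; m+n≡0⇒m≡0; *-suc; m≤n⇒m⊓n≡m; m≤m+n; m≤n+m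
        ; ≤-refl; ≤-trans; <-≤-trans; ≤-<-trans; suc-injective; module ≤-Reasoning )
import Data.Nat.Properties as ℕₚ
open import Data.Product using (Σ-syntax; ∃-syntax; _×_; _,_; proj₁; proj₂)
open import Data.Sum as Sum using (_⊎_; inj₁; inj₂; [_,_]′)
open import Data.Vec.Base using ([]; _∷_; here; there)
open import Function using (_∘_; id)
open import Relation.Nullary using (yes; no; contradiction)
open import Relation.Nullary.Decidable using (does; dec-true; dec-false)
open import Relation.Binary.PropositionalEquality
  using (_≡_; _≢_; refl; sym; trans; cong; cong₂; subst; ≢-sym; module ≡-Reasoning)

-- Occurrences and suffixient sets

module _ {A : Set} where

  EndsAt : List A → List A → ℕ → Set
  EndsAt w y j = ∃[ u ] ∃[ v ] w ≡ u ++ y ++ v × length u + length y ≡ suc j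

  endsAt⇒substring : ∀ {w y j} → EndsAt w y j → Substring y w
  endsAt⇒substring (u , v , w≡ , _) = u , v , w≡

  UniquelyEnding : List A → List A → Set
  UniquelyEnding w y = ∀ {i i'} → EndsAt w y i → EndsAt w y i' → i ≡ i'

  same-start⇒same-end : ∀ {w y i i'} (o : EndsAt w y i) (o' : EndsAt w y i') → proj₁ o ≡ proj₁ o' → i ≡ i'
  same-start⇒same-end (_ , _ , _ , len) (_ , _ , _ , len') refl = suc-injective (trans (sym len) len')

  take-length-++ : (xs ys : List A) → take (length xs) (xs ++ ys) ≡ xs
  take-length-++ []       ys = refl
  take-length-++ (x ∷ xs) ys = cong (x ∷_) (take-length-++ xs ys)

  suffix⇒endsAt : (w : List A) (j : Fin (length w)) {y : List A} →
                  Suffix y (prefixTo w j) → EndsAt w y (toℕ j)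
  suffix⇒endsAt w j {y} (u , prefix≡) = u , drop (suc (toℕ j)) w , w≡ , len
    where
    w≡ : w ≡ u ++ y ++ drop (suc (toℕ j)) w
    w≡ = trans (sym (take++drop≡id (suc (toℕ j)) w)) (trans (cong (_++ _) prefix≡) (++-assoc u y _))
    len : length u + length y ≡ suc (toℕ j)
    len = trans (sym (length-++ u)) (trans (cong length (sym prefix≡))
            (trans (length-take (suc (toℕ j)) w) (m≤n⇒m⊓n≡m (toℕ<n j))))

  endsAt⇒suffix : (w : List A) (j : Fin (length w)) {y : List A} →
                  EndsAt w y (toℕ j) → Suffix y (prefixTo w j)
  endsAt⇒suffix w j {y} (u , v , refl , len) = u , (begin
    take (suc (toℕ j)) (u ++ y ++ v)        ≡⟨ cong₂ take (trans (sym len) (sym (length-++ u))) (sym (++-assoc u y v)) ⟩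
    take (length (u ++ y)) ((u ++ y) ++ v)  ≡⟨ take-length-++ (u ++ y) v ⟩
    u ++ y                                  ∎)
    where open ≡-Reasoning

  ∈-suffixient : ∀ {w S y} (j : Fin (length w)) → Suffixient w S → RightExtension w y →
                 UniquelyEnding w y → EndsAt w y (toℕ j) → j ∈ S
  ∈-suffixient {w} {S} j suff ext unique ends-j with i , i∈S , suf ← suff _ ext =
    subst (_∈ S) (toℕ-injective (unique (suffix⇒endsAt w i suf) ends-j)) i∈S

_∈ᴺ_ : ∀ {m} → ℕ → Subset m → Set
j     ∈ᴺ []      = ⊥
zero  ∈ᴺ (b ∷ p) = b ≡ true
suc j ∈ᴺ (b ∷ p) = j ∈ᴺ p

∈⇒∈ᴺ : ∀ {m} {p : Subset m} {i} → i ∈ p → toℕ i ∈ᴺ p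
∈⇒∈ᴺ here        = refl
∈⇒∈ᴺ (there i∈p) = ∈⇒∈ᴺ i∈p

∈ᴺ⇒∈ : ∀ {m} {p : Subset m} j → j ∈ᴺ p → ∃[ i ] i ∈ p × toℕ i ≡ j
∈ᴺ⇒∈ {p = true ∷ p} zero    refl = zero , here , refl
∈ᴺ⇒∈ {p = b ∷ p}    (suc j) j∈p with i , i∈p , i≡j ← ∈ᴺ⇒∈ j j∈p = suc i , there i∈p , cong suc i≡j

endsAt-∈ᴺ⇒covered : ∀ {A : Set} {w : List A} {S y j} → EndsAt w y j → j ∈ᴺ S →
                    ∃[ i ] i ∈ S × Suffix y (prefixTo w i)
endsAt-∈ᴺ⇒covered {w = w} ends j∈S with i , i∈S , i≡j ← ∈ᴺ⇒∈ _ j∈S =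
  i , i∈S , endsAt⇒suffix w i (subst (EndsAt w _) (sym i≡j) ends)

module _ {A : Set} where

  ++-∷-injective-∉ : ∀ {a : A} u u' {r r'} → All (_≢ a) u → All (_≢ a) u' →
                     u ++ a ∷ r ≡ u' ++ a ∷ r' → u ≡ u' × r ≡ r'
  ++-∷-injective-∉ []      []        _          _          eq = refl , ∷-injectiveʳ eq
  ++-∷-injective-∉ []      (_ ∷ _)   _          (x≢a ∷ _)  eq = ⊥-elim (x≢a (sym (∷-injectiveˡ eq)))
  ++-∷-injective-∉ (_ ∷ _) []        (x≢a ∷ _)  _          eq = ⊥-elim (x≢a (∷-injectiveˡ eq))
  ++-∷-injective-∉ (x ∷ u) (x' ∷ u') (_ ∷ u∌a) (_ ∷ u'∌a) eq with refl , eq' ← ∷-injective eq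
    with refl , r≡r' ← ++-∷-injective-∉ u u' u∌a u'∌a eq' = refl , r≡r'

  replicate-++-∷ : ∀ m (a : A) r → replicate m a ++ a ∷ r ≡ a ∷ replicate m a ++ r
  replicate-++-∷ zero    a r = refl
  replicate-++-∷ (suc m) a r = cong (a ∷_) (replicate-++-∷ m a r)

  replicate-∷ʳ : ∀ m (a : A) → replicate m a ++ [ a ] ≡ replicate (suc m) a
  replicate-∷ʳ m a = trans (replicate-++-∷ m a []) (cong (a ∷_) (++-identityʳ (replicate m a)))

  length-∷ʳ : ∀ (xs : List A) x → length (xs ++ [ x ]) ≡ suc (length xs)
  length-∷ʳ xs x = trans (length-++ xs) (+-comm (length xs) 1)

  ++-assoc-change : ∀ (u x₁ : List A) p q x₂ c v →
                    u ++ ((x₁ ++ p ∷ q ∷ x₂) ++ [ c ]) ++ v ≡ (u ++ x₁) ++ p ∷ q ∷ x₂ ++ c ∷ v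
  ++-assoc-change (y ∷ u) x₁       p q x₂ c v = cong (y ∷_) (++-assoc-change u x₁ p q x₂ c v)
  ++-assoc-change []      (y ∷ x₁) p q x₂ c v = cong (y ∷_) (++-assoc-change [] x₁ p q x₂ c v)
  ++-assoc-change []      []       p q x₂ c v = cong (λ r → p ∷ q ∷ r) (++-assoc x₂ [ c ] v)

-- Letter changes and runs

record Change {A : Set} (w : List A) : Set where
  constructor change
  field
    before : List A
    left right : A
    after : List A
    left≢right : left ≢ right
    split : w ≡ before ++ left ∷ right ∷ after

AtChange : {A : Set} → List A → ℕ → Set
AtChange w j = Σ[ c ∈ Change w ] (j ≡ length (Change.before c) ⊎ j ≡ suc (length (Change.before c)))

EndsWithChange : {A : Set} → List A → Set
EndsWithChange w = Σ[ c ∈ Change w ] Change.after c ≡ []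

atChange-∷ : ∀ {A : Set} {w : List A} {j} a → AtChange w j → AtChange (a ∷ w) (suc j)
atChange-∷ a (change u p q v p≢q w≡ , pos) =
  change (a ∷ u) p q v p≢q (cong (a ∷_) w≡) , Sum.map (cong suc) (cong suc) pos

module _ {n : ℕ} where

  count : Fin n → List (Fin n) → ℕ
  count a = length ∘ filter (_≟ a)

  count-++ : ∀ a xs ys → count a (xs ++ ys) ≡ count a xs + count a ys
  count-++ a xs ys = trans (cong length (filter-++ (_≟ a) xs ys)) (length-++ (filter (_≟ a) xs))

  count-replicate : ∀ a m → count a (replicate m a) ≡ m
  count-replicate a m = trans (cong length (filter-all (_≟ a) (Allₚ.replicate⁺ m refl))) (length-replicate m)

  count-∉ : ∀ {a xs} → All (_≢ a) xs → count a xs ≡ 0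
  count-∉ {a} xs∌a = cong length (filter-none (_≟ a) xs∌a)

  count≡0⇒∉ : ∀ {a} xs → count a xs ≡ 0 → All (_≢ a) xs
  count≡0⇒∉ {a} xs c≡0 = Allₚ.¬Any⇒All¬ xs (λ a∈xs → ℕₚ.<⇒≢ (filter-some (_≟ a) a∈xs) (sym c≡0))

  count-run : ∀ a u m v → count a (u ++ replicate m a ++ v) ≡ count a u + (m + count a v)
  count-run a u m v = begin
    count a (u ++ replicate m a ++ v)                  ≡⟨ count-++ a u _ ⟩
    count a u + count a (replicate m a ++ v)           ≡⟨ cong (count a u +_) (count-++ a (replicate m a) v) ⟩
    count a u + (count a (replicate m a) + count a v)  ≡⟨ cong (λ k → count a u + (k + count a v)) (count-replicate a m) ⟩
    count a u + (m + count a v)                        ∎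
    where open ≡-Reasoning

  ∉-before-full-run : ∀ {a w u v m} → count a w ≡ m → w ≡ u ++ replicate m a ++ v → All (_≢ a) u
  ∉-before-full-run {a} {w} {u} {v} {m} count≡m w≡ =
    count≡0⇒∉ u (m+n≡0⇒m≡0 (count a u) (+-cancelʳ-≡ m _ 0 (begin
      count a u + count a v + m    ≡⟨ +-assoc (count a u) _ m ⟩
      count a u + (count a v + m)  ≡⟨ cong (count a u +_) (+-comm (count a v) m) ⟩
      count a u + (m + count a v)  ≡⟨ sym (trans (cong (count a) w≡) (count-run a u m v)) ⟩
      count a w                    ≡⟨ count≡m ⟩
      m                            ∎)))
    where open ≡-Reasoning

  full-run-unique : ∀ {a w u u' v v' m} → count a w ≡ suc m →
                    w ≡ u ++ replicate (suc m) a ++ v → w ≡ u' ++ replicate (suc m) a ++ v' → u ≡ u'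
  full-run-unique count≡ w≡ w≡' =
    proj₁ (++-∷-injective-∉ _ _ (∉-before-full-run count≡ w≡) (∉-before-full-run count≡ w≡') (trans (sym w≡) w≡'))

  uniquelyEnding-full-run : ∀ {a w m} → count a w ≡ suc m → UniquelyEnding w (replicate (suc m) a)
  uniquelyEnding-full-run count≡ o@(_ , _ , w≡ , _) o'@(_ , _ , w≡' , _) =
    same-start⇒same-end o o' (full-run-unique count≡ w≡ w≡')

  ChangingLettersRepeat : List (Fin n) → Set
  ChangingLettersRepeat w = ∀ {u p q v} → p ≢ q → w ≡ u ++ p ∷ q ∷ v → 2 ≤ count p w

module _ {n : ℕ} where

  differ : Fin n → Fin n → Bool
  differ a b = not (does (a ≟ b))

  differ-≢ : ∀ {a b} → a ≢ b → differ a b ≡ true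
  differ-≢ {a} {b} a≢b = cong not (dec-false (a ≟ b) a≢b)

  differ-refl : ∀ a → differ a a ≡ false
  differ-refl a = cong not (dec-true (a ≟ a) refl)

  differ⇒≢ : ∀ {a b} → differ a b ≡ true → a ≢ b
  differ⇒≢ {a} differs refl with () ← trans (sym differs) (differ-refl a)

  -- Position j of w is flagged when w[j] differs from w[j-1] or from w[j+1];
  -- in boundaryAfter a w, the letter a plays the role of w[-1].
  boundaryAfter : Fin n → (w : List (Fin n)) → Subset (length w)
  boundaryAfter a []          = []
  boundaryAfter a (x ∷ [])    = differ a x ∷ []
  boundaryAfter a (x ∷ y ∷ r) = (differ a x ∨ differ x y) ∷ boundaryAfter x (y ∷ r)

  boundary : (w : List (Fin n)) → Subset (length w)
  boundary []      = []
  boundary (x ∷ w) = boundaryAfter x (x ∷ w)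

  changeˡ∈boundaryAfter : ∀ a u {p q} v → p ≢ q → length u ∈ᴺ boundaryAfter a (u ++ p ∷ q ∷ v)
  changeˡ∈boundaryAfter a []          {p} v p≢q rewrite differ-≢ p≢q = ∨-zeroʳ (differ a p)
  changeˡ∈boundaryAfter a (x ∷ [])    v p≢q = changeˡ∈boundaryAfter x [] v p≢q
  changeˡ∈boundaryAfter a (x ∷ y ∷ u) v p≢q = changeˡ∈boundaryAfter x (y ∷ u) v p≢q

  changeʳ∈boundaryAfter : ∀ a u {p q} v → p ≢ q → suc (length u) ∈ᴺ boundaryAfter a (u ++ p ∷ q ∷ v)
  changeʳ∈boundaryAfter a []          []      p≢q = differ-≢ p≢q
  changeʳ∈boundaryAfter a []          (_ ∷ _) p≢q rewrite differ-≢ p≢q = refl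
  changeʳ∈boundaryAfter a (x ∷ [])    v       p≢q = changeʳ∈boundaryAfter x [] v p≢q
  changeʳ∈boundaryAfter a (x ∷ y ∷ u) v       p≢q = changeʳ∈boundaryAfter x (y ∷ u) v p≢q

  atChange⇒∈boundaryAfter : ∀ a {w j} → AtChange w j → j ∈ᴺ boundaryAfter a w
  atChange⇒∈boundaryAfter a (change u p q v p≢q refl , inj₁ refl) = changeˡ∈boundaryAfter a u v p≢q
  atChange⇒∈boundaryAfter a (change u p q v p≢q refl , inj₂ refl) = changeʳ∈boundaryAfter a u v p≢q

  ∈boundaryAfter⇒atChange : ∀ a w {j} → j ∈ᴺ boundaryAfter a w → AtChange (a ∷ w) (suc j)
  ∈boundaryAfter⇒atChange a (x ∷ [])    {zero}  a≠x = change [] a x [] (differ⇒≢ a≠x) refl , inj₂ refl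
  ∈boundaryAfter⇒atChange a (x ∷ y ∷ r) {zero}  flagged with differ a x in a≠x
  ... | true  = change [] a x (y ∷ r) (differ⇒≢ a≠x) refl , inj₂ refl
  ... | false = change [ a ] x y r (differ⇒≢ flagged) refl , inj₁ refl
  ∈boundaryAfter⇒atChange a (x ∷ y ∷ r) {suc j} j∈ = atChange-∷ a (∈boundaryAfter⇒atChange x (y ∷ r) j∈)

  atChange⇒∈boundary : ∀ {w j} → AtChange w j → j ∈ᴺ boundary w
  atChange⇒∈boundary {x ∷ w} at = atChange⇒∈boundaryAfter x at
  atChange⇒∈boundary {[]} (change []      _ _ _ _ () , _)
  atChange⇒∈boundary {[]} (change (_ ∷ _) _ _ _ _ () , _)

  ∈boundary⇒atChange : ∀ w {j} → j ∈ᴺ boundary w → AtChange w j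
  ∈boundary⇒atChange (x ∷ w) j∈ with ∈boundaryAfter⇒atChange x (x ∷ w) j∈
  ... | change []      p q v p≢q w≡ , _ =
    ⊥-elim (p≢q (trans (sym (∷-injectiveˡ w≡)) (∷-injectiveˡ (∷-injectiveʳ w≡))))
  ... | change (_ ∷ u) p q v p≢q w≡ , pos =
    change u p q v p≢q (∷-injectiveʳ w≡) , Sum.map suc-injective suc-injective pos

-- Nonincreasing words

module _ {n : ℕ} where

  Nonincreasing : List (Fin n) → Set
  Nonincreasing = AllPairs (_≥_ {n})

  nonincreasing-split : ∀ (u : List (Fin n)) {p r} → Nonincreasing (u ++ p ∷ r) → All (_≥ p) u × All (p ≥_) r
  nonincreasing-split []      (p≥r ∷ _) = [] , p≥r
  nonincreasing-split (x ∷ u) (x≥ ∷ ni) with u≥p , p≥r ← nonincreasing-split u ni =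
    All.head (Allₚ.++⁻ʳ u x≥) ∷ u≥p , p≥r

  sandwiched⇒replicate : ∀ {p : Fin n} u → All (p ≥_) u → All (_≥ p) u → u ≡ replicate (length u) p
  sandwiched⇒replicate []      _           _           = refl
  sandwiched⇒replicate (x ∷ u) (p≥x ∷ p≥u) (x≥p ∷ u≥p) =
    cong₂ _∷_ (≤-antisym p≥x x≥p) (sandwiched⇒replicate u p≥u u≥p)

  trailing-run : ∀ (u : List (Fin n)) {p r} → Nonincreasing (u ++ p ∷ r) →
                 ∃[ u₀ ] ∃[ m ] u ≡ u₀ ++ replicate m p × All (Fin._> p) u₀
  trailing-run []      _         = [] , 0 , refl , []
  trailing-run (x ∷ u) {p} (x≥ ∷ ni) with x ≟ p
  ... | yes refl =
    [] , suc (length u) , cong (x ∷_) (sandwiched⇒replicate u (Allₚ.++⁻ˡ u x≥) (proj₁ (nonincreasing-split u ni))) , []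
  ... | no x≢p with u₀ , m , u≡ , u₀>p ← trailing-run u ni =
    x ∷ u₀ , m , cong (x ∷_) u≡ , ≤∧≢⇒< (All.head (Allₚ.++⁻ʳ u x≥)) (≢-sym x≢p) ∷ u₀>p

  power-or-change : ∀ (e : Fin n) x → e ∷ x ≡ replicate (suc (length x)) e ⊎ Change (e ∷ x)
  power-or-change e []      = inj₁ refl
  power-or-change e (y ∷ x) with e ≟ y | power-or-change y x
  ... | yes refl | inj₁ ex≡ = inj₁ (cong (e ∷_) ex≡)
  ... | yes refl | inj₂ (change u p q v p≢q ex≡) = inj₂ (change (e ∷ u) p q v p≢q (cong (e ∷_) ex≡))
  ... | no e≢y   | _        = inj₂ (change [] e y x e≢y refl)

module _ {n : ℕ} {w : List (Fin n)} (ni : Nonincreasing w) where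

  change-separates : ∀ {u p q v} → p ≢ q → w ≡ u ++ p ∷ q ∷ v → All (Fin._> q) (u ++ [ p ]) × All (Fin._< p) (q ∷ v)
  change-separates {u} {p} {q} {v} p≢q w≡
    with u≥p , p≥q ∷ _ ← nonincreasing-split u (subst Nonincreasing w≡ ni)
       | _ , q≥v ← nonincreasing-split (u ++ [ p ]) (subst Nonincreasing (trans w≡ (sym (++-assoc u [ p ] (q ∷ v)))) ni) =
    Allₚ.++⁺ (All.map (<-≤-trans q<p) u≥p) (q<p ∷ []) , q<p ∷ All.map (λ q≥x → ≤-<-trans q≥x q<p) q≥v
    where q<p = ≤∧≢⇒< p≥q (≢-sym p≢q)

  change-unique : ∀ {p q u v u' v'} → p ≢ q → w ≡ u ++ p ∷ q ∷ v → w ≡ u' ++ p ∷ q ∷ v' → u ≡ u' × v ≡ v'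
  change-unique {p} {q} {u} {v} {u'} {v'} p≢q w≡ w≡'
    with ++-∷-injective-∉ (u ++ [ p ]) (u' ++ [ p ]) (q∉ w≡) (q∉ w≡') (trans (sym (reassoc w≡)) (reassoc w≡'))
    where
    reassoc : ∀ {u v} → w ≡ u ++ p ∷ q ∷ v → w ≡ (u ++ [ p ]) ++ q ∷ v
    reassoc {u} w≡ = trans w≡ (sym (++-assoc u [ p ] _))
    q∉ : ∀ {u v} → w ≡ u ++ p ∷ q ∷ v → All (_≢ q) (u ++ [ p ])
    q∉ w≡ = All.map (≢-sym ∘ <⇒≢) (proj₁ (change-separates p≢q w≡))
  ... | u++p≡ , v≡ = ∷ʳ-injectiveˡ u u' u++p≡ , v≡

  uniquelyEnding-change : ∀ {p q} z → p ≢ q → UniquelyEnding w (z ++ p ∷ q ∷ [])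
  uniquelyEnding-change {p} {q} z p≢q o@(u , v , w≡ , _) o'@(u' , v' , w≡' , _) =
    same-start⇒same-end o o' (++-cancelʳ z u u' (proj₁ (change-unique p≢q (reassoc w≡) (reassoc w≡'))))
    where
    reassoc : ∀ {u v} → w ≡ u ++ (z ++ p ∷ q ∷ []) ++ v → w ≡ (u ++ z) ++ p ∷ q ∷ v
    reassoc {u} {v} w≡ = trans w≡ (trans (cong (u ++_) (++-assoc z _ v)) (sym (++-assoc u z _)))

  change⇒run : ∀ {u p q v} → p ≢ q → w ≡ u ++ p ∷ q ∷ v →
    ∃[ u₀ ] ∃[ m ] u ≡ u₀ ++ replicate m p × w ≡ u₀ ++ replicate (suc m) p ++ q ∷ v × count p w ≡ suc m
  change⇒run {u} {p} {q} {v} p≢q w≡ with trailing-run u (subst Nonincreasing w≡ ni)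
  ... | u₀ , m , refl , u₀>p = u₀ , m , refl , w≡₀ , (begin
    count p w                                ≡⟨ trans (cong (count p) w≡₀) (count-run p u₀ (suc m) (q ∷ v)) ⟩
    count p u₀ + (suc m + count p (q ∷ v))   ≡⟨ cong₂ (λ a b → a + (suc m + b))
                                                   (count-∉ (All.map (≢-sym ∘ <⇒≢) u₀>p))
                                                   (count-∉ (All.map <⇒≢ (proj₂ (change-separates p≢q w≡)))) ⟩
    suc m + 0                                ≡⟨ +-identityʳ (suc m) ⟩
    suc m                                    ∎)
    where
    open ≡-Reasoning
    w≡₀ : w ≡ u₀ ++ replicate (suc m) p ++ q ∷ v
    w≡₀ = trans w≡ (trans (++-assoc u₀ (replicate m p) _) (cong (u₀ ++_) (replicate-++-∷ m p (q ∷ v))))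

  rightMaximal⇒power : ∀ {x} → RightMaximal w x → ∃[ e ] ∃[ m ] x ≡ replicate m e
  rightMaximal⇒power {[]}    (a , _) = a , 0 , refl
  rightMaximal⇒power {e ∷ x} (a , b , a≢b , (u₁ , v₁ , w≡₁) , (u₂ , v₂ , w≡₂)) with power-or-change e x
  ... | inj₁ ex≡ = e , suc (length x) , ex≡
  ... | inj₂ (change x₁ p q x₂ p≢q ex≡) =
    ⊥-elim (a≢b (∷-injectiveˡ (++-cancelˡ x₂ _ _ (proj₂ (change-unique p≢q (relocate w≡₁) (relocate w≡₂))))))
    where
    relocate : ∀ {c u v} → w ≡ u ++ (e ∷ x ++ [ c ]) ++ v → w ≡ (u ++ x₁) ++ p ∷ q ∷ x₂ ++ c ∷ v
    relocate {c} {u} {v} w≡ =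
      trans w≡ (trans (cong (λ z → u ++ (z ++ [ c ]) ++ v) ex≡) (++-assoc-change u x₁ p q x₂ c v))

  module _ (ends : EndsWithChange w) where

    run-end-at-boundary : ∀ M {c} u v → w ≡ u ++ replicate (suc M) c ++ v →
                          ∃[ j ] EndsAt w (replicate (suc M) c) j × j ∈ᴺ boundary w
    run-end-at-boundary M {c} u [] w≡ = at-last ends
      where
      at-last : EndsWithChange w → ∃[ j ] EndsAt w (replicate (suc M) c) j × j ∈ᴺ boundary w
      at-last (change u' p q [] p≢q w≡' , refl) =
        suc (length u') , (u , [] , w≡ , len) , atChange⇒∈boundary (change u' p q [] p≢q w≡' , inj₂ refl)
        where
        open ≡-Reasoning
        len : length u + length (replicate (suc M) c) ≡ suc (suc (length u'))
        len = begin
          length u + length (replicate (suc M) c)        ≡⟨ cong (length u +_) (sym (+-identityʳ _)) ⟩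
          length u + (length (replicate (suc M) c) + 0)  ≡⟨ cong (length u +_) (sym (length-++ (replicate (suc M) c))) ⟩
          length u + length (replicate (suc M) c ++ [])  ≡⟨ sym (length-++ u) ⟩
          length (u ++ replicate (suc M) c ++ [])        ≡⟨ cong length (sym w≡) ⟩
          length w                                       ≡⟨ cong length w≡' ⟩
          length (u' ++ p ∷ q ∷ [])                      ≡⟨ length-++ u' ⟩
          length u' + 2                                  ≡⟨ +-comm (length u') 2 ⟩
          suc (suc (length u'))                          ∎
    run-end-at-boundary M {c} u (d ∷ v) w≡ with d ≟ c
    ... | yes refl = run-end-at-boundary M (u ++ [ c ]) v (trans w≡ shifted)
      where
      shifted : u ++ replicate (suc M) c ++ c ∷ v ≡ (u ++ [ c ]) ++ replicate (suc M) c ++ v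
      shifted = trans (cong (λ r → u ++ c ∷ r) (replicate-++-∷ M c v)) (sym (++-assoc u [ c ] _))
    ... | no d≢c = length (u ++ replicate M c) , (u , d ∷ v , w≡ , len) ,
                   atChange⇒∈boundary (change (u ++ replicate M c) c d v (≢-sym d≢c) w≡' , inj₁ refl)
      where
      w≡' : w ≡ (u ++ replicate M c) ++ c ∷ d ∷ v
      w≡' = trans w≡ (trans (cong (u ++_) (sym (replicate-++-∷ M c (d ∷ v)))) (sym (++-assoc u (replicate M c) _)))
      len : length u + length (replicate (suc M) c) ≡ suc (length (u ++ replicate M c))
      len = trans (+-suc (length u) _) (cong suc (sym (length-++ u)))

    power-extension-at-boundary : ∀ m {e c} u v → w ≡ u ++ (replicate m e ++ [ c ]) ++ v →
                                  ∃[ j ] EndsAt w (replicate m e ++ [ c ]) j × j ∈ᴺ boundary w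
    power-extension-at-boundary m {e} {c} u v w≡ with c ≟ e
    ... | yes refl = subst (λ z → ∃[ j ] EndsAt w z j × j ∈ᴺ boundary w) (sym (replicate-∷ʳ m c))
                       (run-end-at-boundary m u v (trans w≡ (cong (λ z → u ++ z ++ v) (replicate-∷ʳ m c))))
    power-extension-at-boundary zero     u v w≡ | no _ = run-end-at-boundary 0 u v w≡
    power-extension-at-boundary (suc m') {e} {c} u v w≡ | no c≢e =
      suc (length (u ++ replicate m' e)) , (u , v , w≡ , len) ,
      atChange⇒∈boundary (change (u ++ replicate m' e) e c v (≢-sym c≢e) w≡' , inj₂ refl)
      where
      open ≡-Reasoning
      w≡' : w ≡ (u ++ replicate m' e) ++ e ∷ c ∷ v
      w≡' = trans w≡ (trans (cong (λ r → u ++ e ∷ r) (++-assoc (replicate m' e) [ c ] v))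
              (trans (cong (u ++_) (sym (replicate-++-∷ m' e (c ∷ v)))) (sym (++-assoc u (replicate m' e) _))))
      len : length u + length (replicate (suc m') e ++ [ c ]) ≡ suc (suc (length (u ++ replicate m' e)))
      len = begin
        length u + suc (length (replicate m' e ++ [ c ]))  ≡⟨ cong (λ k → length u + suc k) (length-∷ʳ (replicate m' e) c) ⟩
        length u + suc (suc (length (replicate m' e)))     ≡⟨ +-suc (length u) _ ⟩
        suc (length u + suc (length (replicate m' e)))     ≡⟨ cong suc (+-suc (length u) _) ⟩
        suc (suc (length u + length (replicate m' e)))     ≡⟨ cong (λ k → suc (suc k)) (sym (length-++ u)) ⟩
        suc (suc (length (u ++ replicate m' e)))           ∎

    boundary-suffixient : Suffixient w (boundary w)
    boundary-suffixient y (x , c , refl , rm , u , v , w≡) with e , m , refl ← rightMaximal⇒power rm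
      with j , ends , j∈ ← power-extension-at-boundary m u v w≡ = endsAt-∈ᴺ⇒covered ends j∈

  module _ (repeat : ChangingLettersRepeat w) where

    change-positions-forced : ∀ {S u₀ m p q v} → Suffixient w S → p ≢ q → count p w ≡ suc (suc m) →
      w ≡ u₀ ++ replicate (suc (suc m)) p ++ q ∷ v → ∀ j →
      toℕ j ≡ length (u₀ ++ replicate (suc m) p) ⊎ toℕ j ≡ suc (length (u₀ ++ replicate (suc m) p)) → j ∈ S
    change-positions-forced {S} {u₀} {m} {p} {q} {v} suff p≢q count≡ w≡ j =
      [ forced p unique-p ends-p , forced q unique-q ends-q ]′
      where
      open ≡-Reasoning
      x = replicate (suc m) p

      ends-p : EndsAt w (x ++ [ p ]) (length (u₀ ++ x))
      ends-p = u₀ , q ∷ v , trans w≡ (cong (λ z → u₀ ++ z ++ q ∷ v) (sym (replicate-∷ʳ (suc m) p))) , (begin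
        length u₀ + length (x ++ [ p ])  ≡⟨ cong (length u₀ +_) (length-∷ʳ x p) ⟩
        length u₀ + suc (length x)       ≡⟨ +-suc (length u₀) _ ⟩
        suc (length u₀ + length x)       ≡⟨ cong suc (sym (length-++ u₀)) ⟩
        suc (length (u₀ ++ x))           ∎)

      ends-q : EndsAt w (x ++ [ q ]) (suc (length (u₀ ++ x)))
      ends-q = u₀ ++ [ p ] , v , trans w≡ (begin
        u₀ ++ p ∷ p ∷ replicate m p ++ q ∷ v  ≡⟨ cong (λ r → u₀ ++ p ∷ p ∷ r) (sym (++-assoc (replicate m p) [ q ] v)) ⟩
        u₀ ++ p ∷ (x ++ [ q ]) ++ v           ≡⟨ sym (++-assoc u₀ [ p ] _) ⟩
        (u₀ ++ [ p ]) ++ (x ++ [ q ]) ++ v    ∎) , (begin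
        length (u₀ ++ [ p ]) + length (x ++ [ q ])  ≡⟨ cong₂ _+_ (length-∷ʳ u₀ p) (length-∷ʳ x q) ⟩
        suc (length u₀ + suc (length x))            ≡⟨ cong suc (+-suc (length u₀) _) ⟩
        suc (suc (length u₀ + length x))            ≡⟨ cong (λ k → suc (suc k)) (sym (length-++ u₀)) ⟩
        suc (suc (length (u₀ ++ x)))                ∎)

      unique-p : UniquelyEnding w (x ++ [ p ])
      unique-p = subst (UniquelyEnding w) (sym (replicate-∷ʳ (suc m) p)) (uniquelyEnding-full-run count≡)

      unique-q : UniquelyEnding w (x ++ [ q ])
      unique-q = subst (UniquelyEnding w) (replicate-++-∷ m p [ q ]) (uniquelyEnding-change (replicate m p) p≢q)

      rightMaximal : RightMaximal w x
      rightMaximal = p , q , p≢q , endsAt⇒substring ends-p , endsAt⇒substring ends-q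

      forced : ∀ c {i} → UniquelyEnding w (x ++ [ c ]) → EndsAt w (x ++ [ c ]) i → toℕ j ≡ i → j ∈ S
      forced c unique ends j≡ =
        ∈-suffixient j suff (x , c , refl , rightMaximal , endsAt⇒substring ends) unique (subst (EndsAt w _) (sym j≡) ends)

    boundary⊆suffixient : ∀ {S} → Suffixient w S → boundary w ⊆ S
    boundary⊆suffixient {S} suff {j} j∈ with ∈boundary⇒atChange w (∈⇒∈ᴺ j∈)
    ... | change u p q v p≢q w≡ , pos with change⇒run p≢q w≡ | repeat p≢q w≡
    ...   | _  , zero  , _    , _   , count≡ | 2≤count = contradiction (subst (2 ≤_) count≡ 2≤count) λ { (s≤s ()) }
    ...   | u₀ , suc m , refl , w≡₀ , count≡ | _       = change-positions-forced suff p≢q count≡ w≡₀ j pos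

  boundary-minSuffixient : EndsWithChange w → ChangingLettersRepeat w → MinSuffixientSize w ∣ boundary w ∣
  boundary-minSuffixient ends repeat =
    (boundary w , boundary-suffixient ends , refl) , λ S suff → p⊆q⇒∣p∣≤∣q∣ (boundary⊆suffixient repeat suff)

-- Counting boundary positions

module _ {n : ℕ} where

  ∣∷∣-shift : ∀ b {m m'} (V : Subset m) (V' : Subset m') k → ∣ V ∣ ≡ k + ∣ V' ∣ → ∣ b ∷ V ∣ ≡ k + ∣ b ∷ V' ∣
  ∣∷∣-shift true  _ _ k eq = trans (cong suc eq) (sym (+-suc k _))
  ∣∷∣-shift false _ _ k eq = eq

  ∣boundaryAfter-run∣ : ∀ (a c z : Fin n) m → c ≢ z →
    ∣ boundaryAfter a (c ∷ c ∷ replicate m c ++ [ z ]) ∣ ≡ 2 + ∣ boundaryAfter a [ c ] ∣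
  ∣boundaryAfter-run∣ a c z zero c≢z rewrite differ-refl c | differ-≢ c≢z | ∨-identityʳ (differ a c) with differ a c
  ... | true  = refl
  ... | false = refl
  ∣boundaryAfter-run∣ a c z (suc m) c≢z =
    trans (cong (λ b → ∣ b ∷ rest ∣) (trans (cong (differ a c ∨_) (differ-refl c)) (∨-identityʳ (differ a c))))
      (∣∷∣-shift (differ a c) rest [] 2 (trans (∣boundaryAfter-run∣ c c z m c≢z) (cong (λ b → 2 + ∣ b ∷ [] ∣) (differ-refl c))))
    where rest = boundaryAfter c (c ∷ c ∷ replicate m c ++ [ z ])

  ∣boundaryAfter-++-run∣ : ∀ (a : Fin n) xs c z m → c ≢ z →
    ∣ boundaryAfter a (xs ++ c ∷ c ∷ replicate m c ++ [ z ]) ∣ ≡ 2 + ∣ boundaryAfter a (xs ++ [ c ]) ∣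
  ∣boundaryAfter-++-run∣ a []           c z m c≢z = ∣boundaryAfter-run∣ a c z m c≢z
  ∣boundaryAfter-++-run∣ a (x ∷ [])     c z m c≢z =
    ∣∷∣-shift (differ a x ∨ differ x c) (boundaryAfter x (c ∷ c ∷ replicate m c ++ [ z ])) (boundaryAfter x [ c ]) 2
      (∣boundaryAfter-run∣ x c z m c≢z)
  ∣boundaryAfter-++-run∣ a (x ∷ y ∷ xs) c z m c≢z =
    ∣∷∣-shift (differ a x ∨ differ x y) (boundaryAfter x (y ∷ xs ++ c ∷ c ∷ replicate m c ++ [ z ]))
      (boundaryAfter x (y ∷ xs ++ [ c ])) 2 (∣boundaryAfter-++-run∣ x (y ∷ xs) c z m c≢z)

  ∣boundary-++-run∣ : ∀ xs (c z : Fin n) m → c ≢ z →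
    ∣ boundary (xs ++ c ∷ c ∷ replicate m c ++ [ z ]) ∣ ≡ 2 + ∣ boundary (xs ++ [ c ]) ∣
  ∣boundary-++-run∣ []       c z m c≢z = ∣boundaryAfter-++-run∣ c [] c z m c≢z
  ∣boundary-++-run∣ (x ∷ xs) c z m c≢z = ∣boundaryAfter-++-run∣ x (x ∷ xs) c z m c≢z

  ∣boundaryAfter-map-suc∣ : ∀ (a : Fin n) w → ∣ boundaryAfter (suc a) (map suc w) ∣ ≡ ∣ boundaryAfter a w ∣
  ∣boundaryAfter-map-suc∣ a []          = refl
  ∣boundaryAfter-map-suc∣ a (x ∷ [])    = refl
  ∣boundaryAfter-map-suc∣ a (x ∷ y ∷ w) =
    ∣∷∣-shift (differ a x ∨ differ x y) (boundaryAfter (suc x) (map suc (y ∷ w))) (boundaryAfter x (y ∷ w)) 0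
      (∣boundaryAfter-map-suc∣ x (y ∷ w))

  ∣boundary-map-suc∣ : ∀ (w : List (Fin n)) → ∣ boundary (map suc w) ∣ ≡ ∣ boundary w ∣
  ∣boundary-map-suc∣ []      = refl
  ∣boundary-map-suc∣ (x ∷ w) = ∣boundaryAfter-map-suc∣ x (x ∷ w)

-- The word K$

Kstr-suc : ∀ σ (k : Fin (suc σ) → ℕ) → Kstr (suc σ) k ≡ map suc (Kstr σ (k ∘ suc)) ++ replicate (k zero) (suc zero)
Kstr-suc σ k = begin
    concatMap g (reverse (zero ∷ tabulate suc))
  ≡⟨ cong (concatMap g) (unfold-reverse zero (tabulate suc)) ⟩
    concatMap g (reverse (tabulate suc) ++ [ zero ])
  ≡⟨ concatMap-++ g (reverse (tabulate suc)) [ zero ] ⟩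
    concatMap g (reverse (tabulate suc)) ++ (g zero ++ [])
  ≡⟨ cong₂ _++_ (cong (concatMap g ∘ reverse) (sym (map-tabulate id suc))) (++-identityʳ (g zero)) ⟩
    concatMap g (reverse (map suc (allFin σ))) ++ g zero
  ≡⟨ cong (λ t → concatMap g t ++ g zero) (sym (reverse-map suc (allFin σ))) ⟩
    concatMap g (map suc R) ++ g zero
  ≡⟨ cong (_++ g zero) (concatMap-map g suc R) ⟩
    concatMap (g ∘ suc) R ++ g zero
  ≡⟨ cong (_++ g zero) (concatMap-cong (λ j → sym (map-replicate suc (k (suc j)) (suc j))) R) ⟩
    concatMap (map suc ∘ g') R ++ g zero
  ≡⟨ cong (_++ g zero) (sym (map-concatMap suc g' R)) ⟩
    map suc (concatMap g' R) ++ g zero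
  ∎
  where
  open ≡-Reasoning
  g : Fin (suc σ) → List (Fin (suc (suc σ)))
  g i = replicate (k i) (suc i)
  g' : Fin σ → List (Fin (suc σ))
  g' j = replicate (k (suc j)) (suc j)
  R = reverse (allFin σ)

K$-suc : ∀ σ (k : Fin (suc σ) → ℕ) →
         K$ (suc σ) k ≡ map suc (Kstr σ (k ∘ suc)) ++ replicate (k zero) (suc zero) ++ [ zero ]
K$-suc σ k = trans (cong (_++ [ zero ]) (Kstr-suc σ k)) (++-assoc (map suc (Kstr σ (k ∘ suc))) _ _)

Kstr-run : ∀ σ k (i : Fin σ) → ∃[ xs ] ∃[ ys ] Kstr σ k ≡ xs ++ replicate (k i) (suc i) ++ ys
Kstr-run σ k i with ys , zs , eq ← ∈-∃++ (reverse⁺ (∈-allFin i)) =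
  concatMap g ys , concatMap g zs , trans (cong (concatMap g) eq) (concatMap-++ g ys (i ∷ zs))
  where
  g : Fin σ → List (Fin (suc σ))
  g i = replicate (k i) (suc i)

nonincreasing-replicate : ∀ {n} m (a : Fin n) → Nonincreasing (replicate m a)
nonincreasing-replicate zero    a = []
nonincreasing-replicate (suc m) a = Allₚ.replicate⁺ m ≤-refl ∷ nonincreasing-replicate m a

nonincreasing-Kstr : ∀ σ k → Nonincreasing (Kstr σ k)
nonincreasing-Kstr zero    k = []
nonincreasing-Kstr (suc σ) k = subst Nonincreasing (sym (Kstr-suc σ k))
  (AllPairsₚ.++⁺ (AllPairsₚ.map⁺ (AllPairs.map s≤s (nonincreasing-Kstr σ (k ∘ suc))))
                 (nonincreasing-replicate (k zero) (suc zero))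
                 (Allₚ.map⁺ (All.universal (λ _ → Allₚ.replicate⁺ (k zero) (s≤s z≤n)) _)))

nonincreasing-K$ : ∀ σ k → Nonincreasing (K$ σ k)
nonincreasing-K$ σ k = AllPairsₚ.++⁺ (nonincreasing-Kstr σ k) ([] ∷ []) (All.universal (λ _ → z≤n ∷ []) _)

count-K$ : ∀ σ k (i : Fin σ) → k i ≤ count (suc i) (K$ σ k)
count-K$ σ k i with xs , ys , Kstr≡ ← Kstr-run σ k i = begin
  k i                                                ≤⟨ m≤m+n (k i) _ ⟩
  k i + count (suc i) ys                             ≤⟨ m≤n+m _ (count (suc i) xs) ⟩
  count (suc i) xs + (k i + count (suc i) ys)        ≡⟨ sym (trans (cong (count (suc i)) Kstr≡) (count-run (suc i) xs (k i) ys)) ⟩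
  count (suc i) (Kstr σ k)                           ≤⟨ m≤m+n _ _ ⟩
  count (suc i) (Kstr σ k) + count (suc i) [ zero ]  ≡⟨ sym (count-++ (suc i) (Kstr σ k) [ zero ]) ⟩
  count (suc i) (K$ σ k)                             ∎
  where open ≤-Reasoning

changingLettersRepeat-K$ : ∀ σ k → (∀ i → 1 < k i) → ChangingLettersRepeat (K$ σ k)
changingLettersRepeat-K$ σ k k>1 {p = suc i} _ _ = ≤-trans (k>1 i) (count-K$ σ k i)
changingLettersRepeat-K$ σ k k>1 {p = zero} {zero} 0≢0 _ = ⊥-elim (0≢0 refl)
-- $ is the least letter, so in a nonincreasing word it is never followed by a different one.
changingLettersRepeat-K$ σ k k>1 {u} {zero} {suc q} _ K$≡
  with _ , () ∷ _ ← nonincreasing-split u (subst Nonincreasing K$≡ (nonincreasing-K$ σ k))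

1<⇒≡2+ : ∀ {m} → 1 < m → ∃[ m' ] m ≡ suc (suc m')
1<⇒≡2+ {suc (suc m')} _       = m' , refl
1<⇒≡2+ {suc zero}     (s≤s ())

endsWithChange-K$ : ∀ σ k → 1 < k zero → EndsWithChange (K$ (suc σ) k)
endsWithChange-K$ σ k k₀>1 with m , k₀≡ ← 1<⇒≡2+ k₀>1 =
  change (xs ++ replicate (suc m) (suc zero)) (suc zero) zero [] (λ ()) K$≡ , refl
  where
  xs = map suc (Kstr σ (k ∘ suc))
  K$≡ : K$ (suc σ) k ≡ (xs ++ replicate (suc m) (suc zero)) ++ suc zero ∷ zero ∷ []
  K$≡ = trans (K$-suc σ k) (trans (cong (λ r → xs ++ replicate r (suc zero) ++ [ zero ]) k₀≡)
          (trans (cong (xs ++_) (sym (replicate-++-∷ (suc m) (suc zero) [ zero ]))) (sym (++-assoc xs _ _))))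

∣boundary-K$∣ : ∀ σ k → (∀ i → 1 < k i) → ∣ boundary (K$ σ k) ∣ ≡ 2 * σ
∣boundary-K$∣ zero    k k>1 = refl
∣boundary-K$∣ (suc σ) k k>1 with m , k₀≡ ← 1<⇒≡2+ (k>1 zero) = begin
  ∣ boundary (K$ (suc σ) k) ∣                    ≡⟨ cong (∣_∣ ∘ boundary) K$≡ ⟩
  ∣ boundary (xs ++ s₀ ∷ s₀ ∷ replicate m s₀ ++ [ zero ]) ∣
                                                 ≡⟨ ∣boundary-++-run∣ xs s₀ zero m (λ ()) ⟩
  2 + ∣ boundary (xs ++ [ s₀ ]) ∣                ≡⟨ cong (λ t → 2 + ∣ boundary t ∣) (sym (map-++ suc (Kstr σ (k ∘ suc)) [ zero ])) ⟩
  2 + ∣ boundary (map suc (K$ σ (k ∘ suc))) ∣    ≡⟨ cong (2 +_) (∣boundary-map-suc∣ (K$ σ (k ∘ suc))) ⟩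
  2 + ∣ boundary (K$ σ (k ∘ suc)) ∣              ≡⟨ cong (2 +_) (∣boundary-K$∣ σ (k ∘ suc) (k>1 ∘ suc)) ⟩
  2 + 2 * σ                                      ≡⟨ sym (*-suc 2 σ) ⟩
  2 * suc σ                                      ∎
  where
  open ≡-Reasoning
  s₀ = suc zero
  xs = map suc (Kstr σ (k ∘ suc))
  K$≡ : K$ (suc σ) k ≡ xs ++ s₀ ∷ s₀ ∷ replicate m s₀ ++ [ zero ]
  K$≡ = trans (K$-suc σ k) (cong (λ r → xs ++ replicate r s₀ ++ [ zero ]) k₀≡)

lemma2 : (σ : ℕ) → 1 ≤ σ → (k : Fin σ → ℕ) → (∀ i → 1 < k i) →
    MinSuffixientSize (K$ σ k) (2 * σ)
lemma2 (suc σ) _ k k>1 =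
  subst (MinSuffixientSize (K$ (suc σ) k)) (∣boundary-K$∣ (suc σ) k k>1)
    (boundary-minSuffixient (nonincreasing-K$ (suc σ) k) (endsWithChange-K$ σ k (k>1 zero))
      (changingLettersRepeat-K$ (suc σ) k k>1))
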